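{- Let $G$ be a finite group and let $Max_G=\{x_1,\dots,x_m\}$ be an essential cyclic set of $G$ with $m\geq 4$. If $icn(G)=2$, then $rc(\Gamma_G^e)=3$.
   Context: Let $G$ be a finite group with identity $e$. The enhanced power graph $\Gamma_G^e$ has vertex set $G$, two distinct vertices $x,y$ being adjacent iff $x,y\in\langle z\rangle$ for some $z\in G$. For a connected graph $\Gamma$, an edge-colouring $\zeta:E(\Gamma)\to\{1,\dots,k\}$ (not necessarily proper) is a rainbow $k$-colouring if every pair of distinct vertices is joined by a path whose edges have pairwise distinct colours; $rc(\Gamma)$ is the minimum such $k$. An essential cyclic set $Max_G=\{x_1,\dots,x_m\}$ is a set of elements of $G$ such that $\langle x_1\rangle,\dots,\langle x_m\rangle$ are pairwise distinct and are exactly the maximal cyclic subgroups of $G$. The independence cyclic set is $ics(G)=\{x_i\in Max_G:\langle x_i\rangle\cap\langle x_j\rangle=\{e\}\text{ for all }j\neq i\}$ and $icn(G)=|ics(G)|$. -}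

module Defs where

open import Data.Nat using (ℕ; zero; suc; _<_)
open import Data.Integer using (ℤ; +_; -[1+_])
open import Data.Fin using (Fin)
open import Data.List using (List; []; _∷_)
open import Data.List.Relation.Unary.Unique.Propositional using (Unique)
open import Data.Product using (Σ; _×_; ∃; ∃-syntax; _,_)
open import Relation.Nullary using (¬_)
open import Relation.Binary.PropositionalEquality using (_≡_; _≢_)
open import Algebra.Structures using (IsGroup)
open import Function.Definitions using (Injective)

record FinGroup : Set where
  field
    order   : ℕ
    _∙_     : Fin order → Fin order → Fin order
    e       : Fin order
    _⁻¹     : Fin order → Fin order
    isGroup : IsGroup _≡_ _∙_ e _⁻¹

module _ (G : FinGroup) where
  open FinGroup G

  El : Set
  El = Fin order

  npow : El → ℕ → El
  npow x zero    = e
  npow x (suc k) = x ∙ npow x k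

  zpow : El → ℤ → El
  zpow x (+ k)      = npow x k
  zpow x -[1+ k ]   = npow (x ⁻¹) (suc k)

  _∈⟨_⟩ : El → El → Set
  x ∈⟨ z ⟩ = ∃[ k ] zpow z k ≡ x

  _⊆⟨⟩_ : El → El → Set
  z ⊆⟨⟩ w = ∀ g → g ∈⟨ z ⟩ → g ∈⟨ w ⟩

  _≐⟨⟩_ : El → El → Set
  z ≐⟨⟩ w = (z ⊆⟨⟩ w) × (w ⊆⟨⟩ z)

  MaximalCyclic : El → Set
  MaximalCyclic z = ∀ w → z ⊆⟨⟩ w → w ⊆⟨⟩ z

  IsEssentialCyclicSet : (m : ℕ) → (Fin m → El) → Set
  IsEssentialCyclicSet m xs =
    (∀ i j → i ≢ j → ¬ (xs i ≐⟨⟩ xs j)) ×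
    (∀ i → MaximalCyclic (xs i)) ×
    (∀ z → MaximalCyclic z → ∃[ i ] (z ≐⟨⟩ xs i))

  InIcs : (m : ℕ) → (Fin m → El) → Fin m → Set
  InIcs m xs i = ∀ j → j ≢ i → ∀ g → g ∈⟨ xs i ⟩ → g ∈⟨ xs j ⟩ → g ≡ e

  -- icn(G) = c : the set ics(G) ⊆ Max_G has exactly c elements
  -- (indices i are in bijection with the x_i, the ⟨x_i⟩ being pairwise distinct)
  IcnIs : (m : ℕ) → (Fin m → El) → ℕ → Set
  IcnIs m xs c =
    Σ (Fin c → Fin m) λ f →
      Injective _≡_ _≡_ f × (∀ t → InIcs m xs (f t)) ×
      (∀ i → InIcs m xs i → ∃[ t ] f t ≡ i)

  EPAdj : El → El → Set
  EPAdj x y = x ≢ y × ∃[ z ] (x ∈⟨ z ⟩ × y ∈⟨ z ⟩)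

module _ {n : ℕ} (Adj : Fin n → Fin n → Set) where

  record EdgeColouring (k : ℕ) : Set where
    field
      colour  : ∀ x y → Adj x y → Fin k
      wellDef : ∀ x y (a : Adj x y) (b : Adj y x) → colour x y a ≡ colour y x b

  data Walk : Fin n → Fin n → List (Fin n) → Set where
    here : ∀ {x} → Walk x x (x ∷ [])
    step : ∀ {x y z vs} → Adj x y → Walk y z vs → Walk x z (x ∷ vs)

  walkColours : ∀ {k x y vs} → EdgeColouring k → Walk x y vs → List (Fin k)
  walkColours ζ here = []
  walkColours ζ (step {x} {y} a w) = EdgeColouring.colour ζ x y a ∷ walkColours ζ w

  RainbowPath : ∀ {k} → EdgeColouring k → Fin n → Fin n → Set
  RainbowPath ζ x y =
    ∃[ vs ] Σ (Walk x y vs) λ w → Unique vs × Unique (walkColours ζ w)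

  IsRainbowColouring : ∀ {k} → EdgeColouring k → Set
  IsRainbowColouring ζ = ∀ x y → x ≢ y → RainbowPath ζ x y

  HasRainbowColouring : ℕ → Set
  HasRainbowColouring k = Σ (EdgeColouring k) IsRainbowColouring

  RcIs : ℕ → Set
  RcIs k = HasRainbowColouring k × (∀ j → j < k → ¬ HasRainbowColouring j)

module Submission where

-- Lower bound: generators of different maximal cyclic subgroups are non-adjacent, and
-- if xᵢ ∈ ics(G) their only common neighbour with any xₖ is e. With fewer than three
-- colours a rainbow xᵢ–xₖ path therefore is xᵢ – e – xₖ, so the spokes e – xᵢ of the two
-- members of ics(G) and of a third generator would need three distinct colours.
--
-- Upper bound: sort the vertices into five kinds (e, in ⟨x₁⟩, in ⟨x₂⟩ only, shared by
-- two maximal cyclic subgroups, lying in just one other) and colour every edge by the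
-- sum of labels of its kinds mod 3. Paths through e, and for the remaining cases paths
-- through a lone neighbour of a shared vertex or a shared neighbour of a lone vertex
-- (which exists since icn(G) = 2), are rainbow.

open import Defs hiding (_∈⟨_⟩; _⊆⟨⟩_)
open import Level using (0ℓ)
open import Algebra.Bundles using (Group)
open import Algebra.Structures using (IsGroup)
open import Data.Nat using (ℕ; zero; suc; _+_; _*_; _≤_; _<_; z≤n; s≤s)
open import Data.Nat.DivMod using (_mod_)
import Data.Nat.Properties as ℕP
open import Data.Integer using (+_; -[1+_])
open import Data.Fin as Fin using (Fin; toℕ)
import Data.Fin.Properties as FinP
import Data.Fin.Subset as Subset
import Data.Fin.Subset.Properties as SubsetP
open import Data.Vec using (tabulate)
open import Data.Vec.Properties using (lookup∘tabulate; lookup⇒[]=; []=⇒lookup)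
open import Data.Product using (Σ; _×_; ∃; _,_; proj₁; proj₂)
open import Data.Sum using (inj₁; inj₂)
open import Data.Bool using (if_then_else_)
open import Data.Empty using (⊥; ⊥-elim)
open import Data.List using ([]; _∷_)
open import Data.List.Relation.Unary.Unique.Propositional using (Unique)
open import Data.List.Relation.Unary.AllPairs using ([]; _∷_)
import Data.List.Relation.Unary.All as All
open import Function using (_∘_; case_of_)
open import Relation.Nullary using (¬_; Dec; yes; no; does)
open import Relation.Nullary.Decidable using (_→-dec_; _×-dec_; ¬?; dec-true; dec-false; decidable-stable)
open import Relation.Binary.PropositionalEquality

module CyclicSubgroups (G : FinGroup) where
  open FinGroup G
  open IsGroup isGroup using (identityʳ)

  group : Group 0ℓ 0ℓ
  group = record { isGroup = isGroup }

  open import Algebra.Properties.Group group using (∙-cancelˡ; inverseʳ-unique)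
  open import Algebra.Properties.Monoid.Mult (Group.monoid group)
    using (×-homo-+; ×-assocˡ) renaming (_×_ to _·_)

  infix 4 _∈⟨_⟩ _⊆⟨⟩_
  infixr 30 _^_

  _∈⟨_⟩ : El G → El G → Set
  _∈⟨_⟩ = Defs._∈⟨_⟩ G

  _⊆⟨⟩_ : El G → El G → Set
  _⊆⟨⟩_ = Defs._⊆⟨⟩_ G

  _^_ : El G → ℕ → El G
  _^_ = npow G

  ^≡· : ∀ x n → x ^ n ≡ n · x
  ^≡· x zero    = refl
  ^≡· x (suc n) = cong (x ∙_) (^≡· x n)

  ^-+ : ∀ x i j → x ^ (i + j) ≡ x ^ i ∙ x ^ j
  ^-+ x i j = begin
    x ^ (i + j)       ≡⟨ ^≡· x (i + j) ⟩
    (i + j) · x       ≡⟨ ×-homo-+ x i j ⟩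
    (i · x) ∙ (j · x) ≡⟨ sym (cong₂ _∙_ (^≡· x i) (^≡· x j)) ⟩
    x ^ i ∙ x ^ j     ∎
    where open ≡-Reasoning

  ^-* : ∀ x i n → (x ^ i) ^ n ≡ x ^ (n * i)
  ^-* x i n = begin
    (x ^ i) ^ n       ≡⟨ ^≡· (x ^ i) n ⟩
    n · (x ^ i)       ≡⟨ cong (n ·_) (^≡· x i) ⟩
    n · (i · x)       ≡⟨ ×-assocˡ x n i ⟩
    (n * i) · x       ≡⟨ sym (^≡· x (n * i)) ⟩
    x ^ (n * i)       ∎
    where open ≡-Reasoning

  ∈-identity : ∀ z → e ∈⟨ z ⟩
  ∈-identity z = + 0 , refl

  ∈-self : ∀ z → z ∈⟨ z ⟩
  ∈-self z = + 1 , identityʳ z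

  -- every element has finite order: two of the powers z⁰,…,z^order coincide
  finiteOrder : ∀ z → ∃ λ q → z ^ suc q ≡ e
  finiteOrder z with FinP.pigeonhole (ℕP.n<1+n order) (λ i → z ^ toℕ i)
  ... | i , j , i<j , zⁱ≡zʲ with ℕP.m≤n⇒∃[o]m+o≡n i<j
  ... | q , i+1+q≡j = q , ∙-cancelˡ (z ^ toℕ i) _ _ (begin
    z ^ toℕ i ∙ z ^ suc q  ≡⟨ sym (^-+ z (toℕ i) (suc q)) ⟩
    z ^ (toℕ i + suc q)    ≡⟨ cong (z ^_) (trans (ℕP.+-suc (toℕ i) q) i+1+q≡j) ⟩
    z ^ toℕ j              ≡⟨ sym zⁱ≡zʲ ⟩
    z ^ toℕ i              ≡⟨ sym (identityʳ _) ⟩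
    z ^ toℕ i ∙ e          ∎)
    where open ≡-Reasoning

  -- hence negative powers are positive powers, since z⁻¹ = z^q when z^(q+1) = e
  naturalPower : ∀ {x z} → x ∈⟨ z ⟩ → ∃ λ n → z ^ n ≡ x
  naturalPower (+ n , zⁿ≡x) = n , zⁿ≡x
  naturalPower {x} {z} (-[1+ n ] , z⁻ⁿ≡x) with finiteOrder z
  ... | q , z^q+1≡e = suc n * q , (begin
    z ^ (suc n * q)        ≡⟨ sym (^-* z q (suc n)) ⟩
    (z ^ q) ^ suc n        ≡⟨ cong (_^ suc n) (inverseʳ-unique z (z ^ q) z^q+1≡e) ⟩
    (z ⁻¹) ^ suc n         ≡⟨ z⁻ⁿ≡x ⟩
    x                      ∎)
    where open ≡-Reasoning

  generated-⊆ : ∀ {a z} → a ∈⟨ z ⟩ → a ⊆⟨⟩ z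
  generated-⊆ {a} {z} a∈z g g∈a with naturalPower a∈z | naturalPower g∈a
  ... | i , refl | n , refl = + (n * i) , sym (^-* z i n)

  boundedPower : ∀ z q → z ^ suc q ≡ e → ∀ n → ∃ λ j → j < suc q × z ^ j ≡ z ^ n
  boundedPower z q z^q+1≡e zero = 0 , s≤s z≤n , refl
  boundedPower z q z^q+1≡e (suc n) with boundedPower z q z^q+1≡e n
  ... | j , s≤s j≤q , zʲ≡zⁿ with ℕP.m≤n⇒m<n∨m≡n j≤q
  ...   | inj₁ j<q  = suc j , s≤s j<q , cong (z ∙_) zʲ≡zⁿ
  ...   | inj₂ refl = 0 , s≤s z≤n , trans (sym z^q+1≡e) (cong (z ∙_) zʲ≡zⁿ)

  -- the decision procedures are opaque: only their verdicts are used, never their computation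
  opaque
    _∈?⟨_⟩ : ∀ x z → Dec (x ∈⟨ z ⟩)
    x ∈?⟨ z ⟩ with finiteOrder z
    ... | q , z^q+1≡e with FinP.any? (λ (j : Fin (suc q)) → z ^ toℕ j Fin.≟ x)
    ...   | yes (j , zʲ≡x) = yes (+ toℕ j , zʲ≡x)
    ...   | no noPower = no λ x∈z →
      let (n , zⁿ≡x)     = naturalPower x∈z
          (j , j<q+1 , zʲ≡zⁿ) = boundedPower z q z^q+1≡e n
      in noPower (Fin.fromℕ< j<q+1 ,
                  trans (cong (z ^_) (FinP.toℕ-fromℕ< j<q+1)) (trans zʲ≡zⁿ zⁿ≡x))

    _⊆?_ : ∀ z w → Dec (z ⊆⟨⟩ w)
    z ⊆? w = FinP.all? λ g → g ∈?⟨ z ⟩ →-dec g ∈?⟨ w ⟩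

  elements : El G → Subset.Subset order
  elements z = tabulate λ g → does (g ∈?⟨ z ⟩)

  ∈-elements : ∀ {g z} → g ∈⟨ z ⟩ → g Subset.∈ elements z
  ∈-elements {g} {z} g∈z =
    lookup⇒[]= g (elements z) (trans (lookup∘tabulate _ g) (dec-true (g ∈?⟨ z ⟩) g∈z))

  elements-∈ : ∀ {g z} → g Subset.∈ elements z → g ∈⟨ z ⟩
  elements-∈ {g} {z} g∈ with g ∈?⟨ z ⟩ | trans (sym (lookup∘tabulate _ g)) ([]=⇒lookup g∈)
  ... | yes g∈z | _ = g∈z
  ... | no _    | ()

  strictly-larger : ∀ {z w} → z ⊆⟨⟩ w → ¬ (w ⊆⟨⟩ z) →
                    Subset.∣ elements z ∣ < Subset.∣ elements w ∣
  strictly-larger {z} {w} z⊆w w⊈z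
    with FinP.¬∀⟶∃¬ order (λ g → g ∈⟨ w ⟩ → g ∈⟨ z ⟩) (λ g → g ∈?⟨ w ⟩ →-dec g ∈?⟨ z ⟩) w⊈z
  ... | g , g∈w∖z = SubsetP.p⊂q⇒∣p∣<∣q∣
    ((λ {h} h∈ → ∈-elements (z⊆w h (elements-∈ h∈))) ,
     g , ∈-elements g∈w , λ g∈ → g∈w∖z (λ _ → elements-∈ g∈))
    where
    g∈w : g ∈⟨ w ⟩
    g∈w = decidable-stable (g ∈?⟨ w ⟩) λ g∉w → g∈w∖z λ g∈w → ⊥-elim (g∉w g∈w)

  -- climbing through strictly larger cyclic subgroups must stop, since sizes are bounded by |G|
  climb : ∀ room z → order < Subset.∣ elements z ∣ + room →
          ∃ λ w → z ⊆⟨⟩ w × MaximalCyclic G w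
  climb zero z bound = ⊥-elim (ℕP.<⇒≱ bound
    (ℕP.≤-trans (ℕP.≤-reflexive (ℕP.+-identityʳ _)) (SubsetP.∣p∣≤n (elements z))))
  climb (suc room) z bound = climbFrom (FinP.any? λ w → z ⊆? w ×-dec ¬? (w ⊆? z))
    where
    climbFrom : Dec (∃ λ w → z ⊆⟨⟩ w × ¬ (w ⊆⟨⟩ z)) → ∃ λ w → z ⊆⟨⟩ w × MaximalCyclic G w
    climbFrom (no noLarger) = z , (λ _ g∈z → g∈z) ,
      λ w z⊆w → decidable-stable (w ⊆? z) λ w⊈z → noLarger (w , z⊆w , w⊈z)
    climbFrom (yes (w , z⊆w , w⊈z)) =
      let (v , w⊆v , maximal) = climb room w (ℕP.<-≤-trans bound
            (ℕP.≤-trans (ℕP.≤-reflexive (ℕP.+-suc _ room))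
                        (ℕP.+-monoˡ-≤ room (strictly-larger z⊆w w⊈z))))
      in v , (λ g g∈z → w⊆v g (z⊆w g g∈z)) , maximal

  maximalAbove : ∀ z → ∃ λ w → z ⊆⟨⟩ w × MaximalCyclic G w
  maximalAbove z = climb (suc order) z (ℕP.<-≤-trans (ℕP.n<1+n order) (ℕP.m≤n+m (suc order) _))

anotherIndex : ∀ {m} → 2 ≤ m → (i : Fin m) → ∃ λ k → k ≢ i
anotherIndex (s≤s (s≤s _)) Fin.zero    = Fin.suc Fin.zero , λ ()
anotherIndex (s≤s (s≤s _)) (Fin.suc i) = Fin.zero , λ ()

thirdIndex : ∀ {m} → 3 ≤ m → (i j : Fin m) → ∃ λ k → k ≢ i × k ≢ j
thirdIndex {suc (suc (suc m))} (s≤s (s≤s (s≤s _))) = pick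
  where
  pick : (i j : Fin (suc (suc (suc m)))) → ∃ λ k → k ≢ i × k ≢ j
  pick Fin.zero Fin.zero                      = Fin.suc Fin.zero , (λ ()) , (λ ())
  pick Fin.zero (Fin.suc Fin.zero)            = Fin.suc (Fin.suc Fin.zero) , (λ ()) , (λ ())
  pick Fin.zero (Fin.suc (Fin.suc j))         = Fin.suc Fin.zero , (λ ()) , (λ ())
  pick (Fin.suc Fin.zero) Fin.zero            = Fin.suc (Fin.suc Fin.zero) , (λ ()) , (λ ())
  pick (Fin.suc (Fin.suc i)) Fin.zero         = Fin.suc Fin.zero , (λ ()) , (λ ())
  pick (Fin.suc i) (Fin.suc j)                = Fin.zero , (λ ()) , (λ ())

noThreeDistinct : ∀ {j} → j < 3 → (a b c : Fin j) → a ≢ b → a ≢ c → b ≢ c → ⊥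
noThreeDistinct {0} _ () _ _ _ _ _
noThreeDistinct {1} _ Fin.zero Fin.zero _ a≢b _ _ = a≢b refl
noThreeDistinct {2} _ Fin.zero Fin.zero _ a≢b _ _ = a≢b refl
noThreeDistinct {2} _ (Fin.suc Fin.zero) (Fin.suc Fin.zero) _ a≢b _ _ = a≢b refl
noThreeDistinct {2} _ Fin.zero (Fin.suc Fin.zero) Fin.zero _ a≢c _ = a≢c refl
noThreeDistinct {2} _ Fin.zero (Fin.suc Fin.zero) (Fin.suc Fin.zero) _ _ b≢c = b≢c refl
noThreeDistinct {2} _ (Fin.suc Fin.zero) Fin.zero Fin.zero _ _ b≢c = b≢c refl
noThreeDistinct {2} _ (Fin.suc Fin.zero) Fin.zero (Fin.suc Fin.zero) _ a≢c _ = a≢c refl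
noThreeDistinct {suc (suc (suc _))} (s≤s (s≤s (s≤s ()))) _ _ _ _ _ _

module RainbowPaths {n k : ℕ} {Adj : Fin n → Fin n → Set} (ζ : EdgeColouring Adj k)
                    (loopless : ∀ {x y} → Adj x y → x ≢ y) where
  open EdgeColouring ζ

  colour-irrelevant : ∀ {x y} → Adj y x → (a a′ : Adj x y) → colour x y a ≡ colour x y a′
  colour-irrelevant b a a′ = trans (wellDef _ _ a b) (sym (wellDef _ _ a′ b))

  edgePath : ∀ {x y} → Adj x y → RainbowPath Adj ζ x y
  edgePath {x} {y} a = (x ∷ y ∷ []) , step a here ,
    ((loopless a All.∷ All.[]) ∷ All.[] ∷ []) , (All.[] ∷ [])

  twoEdgePath : ∀ {x y z} (a : Adj x y) (b : Adj y z) → x ≢ z →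
                colour x y a ≢ colour y z b → RainbowPath Adj ζ x z
  twoEdgePath {x} {y} {z} a b x≢z ab = (x ∷ y ∷ z ∷ []) , step a (step b here) ,
    ((loopless a All.∷ x≢z All.∷ All.[]) ∷ (loopless b All.∷ All.[]) ∷ All.[] ∷ []) ,
    ((ab All.∷ All.[]) ∷ All.[] ∷ [])

  threeEdgePath : ∀ {x y z u} (a : Adj x y) (b : Adj y z) (c : Adj z u) →
                  x ≢ z → x ≢ u → y ≢ u →
                  colour x y a ≢ colour y z b → colour x y a ≢ colour z u c →
                  colour y z b ≢ colour z u c → RainbowPath Adj ζ x u
  threeEdgePath {x} {y} {z} {u} a b c x≢z x≢u y≢u ab ac bc =
    (x ∷ y ∷ z ∷ u ∷ []) , step a (step b (step c here)) ,
    ((loopless a All.∷ x≢z All.∷ x≢u All.∷ All.[]) ∷ (loopless b All.∷ y≢u All.∷ All.[]) ∷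
     (loopless c All.∷ All.[]) ∷ All.[] ∷ []) ,
    ((ab All.∷ ac All.∷ All.[]) ∷ (bc All.∷ All.[]) ∷ All.[] ∷ [])

  twoColourRainbow : k < 3 → ∀ {x z vs} (w : Walk Adj x z vs) → Unique (walkColours Adj ζ w) →
                     x ≢ z → ¬ Adj x z →
                     ∃ λ y → Σ (Adj x y) λ a → Σ (Adj y z) λ b → colour x y a ≢ colour y z b
  twoColourRainbow _ here _ x≢x _ = ⊥-elim (x≢x refl)
  twoColourRainbow _ (step a here) _ _ nonAdjacent = ⊥-elim (nonAdjacent a)
  twoColourRainbow _ (step a (step b here)) (distinct ∷ _) _ _ = _ , a , b , All.head distinct
  twoColourRainbow k<3 (step a (step b (step c _))) (distinct₁ ∷ distinct₂ ∷ _) _ _ =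
    ⊥-elim (noThreeDistinct k<3 _ _ _ (All.head distinct₁) (All.head (All.tail distinct₁))
                                      (All.head distinct₂))

module EnhancedPowerGraph (G : FinGroup) where
  open FinGroup G
  open CyclicSubgroups G

  adjacent-sym : ∀ {x y} → EPAdj G x y → EPAdj G y x
  adjacent-sym (x≢y , z , x∈z , y∈z) = x≢y ∘ sym , z , y∈z , x∈z

  spoke : ∀ {v} → v ≢ e → EPAdj G e v
  spoke {v} v≢e = v≢e ∘ sym , v , ∈-identity v , ∈-self v

module EssentialCyclicSet (G : FinGroup) {m : ℕ} (xs : Fin m → El G)
                          (essential : IsEssentialCyclicSet G m xs) where
  open FinGroup G
  open CyclicSubgroups G

  private
    distinct : ∀ i k → i ≢ k → ¬ (Defs._≐⟨⟩_ G (xs i) (xs k))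
    distinct = proj₁ essential
    maximal : ∀ i → MaximalCyclic G (xs i)
    maximal = proj₁ (proj₂ essential)
    complete : ∀ z → MaximalCyclic G z → ∃ λ i → Defs._≐⟨⟩_ G z (xs i)
    complete = proj₂ (proj₂ essential)

  absorbed : ∀ {i z} → xs i ∈⟨ z ⟩ → z ⊆⟨⟩ xs i
  absorbed {i} xᵢ∈z = maximal i _ (generated-⊆ xᵢ∈z)

  -- no cyclic subgroup contains two different generators of Max_G, since both would
  -- then generate it
  sameIndex : ∀ {i k z} → xs i ∈⟨ z ⟩ → xs k ∈⟨ z ⟩ → i ≡ k
  sameIndex {i} {k} xᵢ∈z xₖ∈z with i Fin.≟ k
  ... | yes i≡k = i≡k
  ... | no i≢k  = ⊥-elim (distinct i k i≢k
    ((λ g g∈xᵢ → absorbed xₖ∈z g (generated-⊆ xᵢ∈z g g∈xᵢ)) ,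
     (λ g g∈xₖ → absorbed xᵢ∈z g (generated-⊆ xₖ∈z g g∈xₖ))))

  generatorIndex : ∀ {i k} → xs i ∈⟨ xs k ⟩ → i ≡ k
  generatorIndex xᵢ∈xₖ = sameIndex xᵢ∈xₖ (∈-self _)

  generator-injective : ∀ {i k} → i ≢ k → xs i ≢ xs k
  generator-injective {i} i≢k xᵢ≡xₖ =
    i≢k (sameIndex (∈-self (xs i)) (subst (_∈⟨ xs i ⟩) xᵢ≡xₖ (∈-self (xs i))))

  generatorsNonAdjacent : ∀ {i k} → i ≢ k → ¬ EPAdj G (xs i) (xs k)
  generatorsNonAdjacent i≢k (_ , _ , xᵢ∈z , xₖ∈z) = i≢k (sameIndex xᵢ∈z xₖ∈z)

  neighbourIn : ∀ {i y} → EPAdj G (xs i) y → y ∈⟨ xs i ⟩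
  neighbourIn (_ , _ , xᵢ∈z , y∈z) = absorbed xᵢ∈z _ y∈z

  -- were xᵢ = e, then ⟨xᵢ⟩ ⊆ ⟨xₖ⟩ for every k
  generatorNonIdentity : 2 ≤ m → ∀ i → xs i ≢ e
  generatorNonIdentity 2≤m i xᵢ≡e with anotherIndex 2≤m i
  ... | k , k≢i = k≢i (sym (generatorIndex (subst (_∈⟨ xs k ⟩) (sym xᵢ≡e) (∈-identity (xs k)))))

  Shared : El G → Set
  Shared g = ∃ λ i → ∃ λ k → i ≢ k × g ∈⟨ xs i ⟩ × g ∈⟨ xs k ⟩

  opaque
    -- every element lies in some ⟨xᵢ⟩, because it lies in a maximal cyclic subgroup
    covered : ∀ g → ∃ λ i → g ∈⟨ xs i ⟩
    covered g with maximalAbove g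
    ... | w , g⊆w , w-maximal with complete w w-maximal
    ...   | i , w⊆xᵢ , _ = i , w⊆xᵢ g (g⊆w g (∈-self g))

    shared? : ∀ g → Dec (Shared g)
    shared? g = FinP.any? λ i → FinP.any? λ k →
      ¬? (i Fin.≟ k) ×-dec g ∈?⟨ xs i ⟩ ×-dec g ∈?⟨ xs k ⟩

    sharedWitness : ∀ i → ¬ InIcs G m xs i →
                    ∃ λ g → g ≢ e × g ∈⟨ xs i ⟩ × ∃ λ k → k ≢ i × g ∈⟨ xs k ⟩
    sharedWitness i notIcs
      with FinP.any? (λ g → ¬? (g Fin.≟ e) ×-dec g ∈?⟨ xs i ⟩ ×-dec
                            FinP.any? λ k → ¬? (k Fin.≟ i) ×-dec g ∈?⟨ xs k ⟩)
    ... | yes witness = witness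
    ... | no none = ⊥-elim (notIcs λ k k≢i g g∈xᵢ g∈xₖ →
          decidable-stable (g Fin.≟ e) λ g≢e → none (g , g≢e , g∈xᵢ , k , k≢i , g∈xₖ))

  icsAvoidsShared : ∀ {i g} → InIcs G m xs i → g ≢ e → Shared g → ¬ g ∈⟨ xs i ⟩
  icsAvoidsShared {i} ics g≢e (a , b , a≢b , g∈xₐ , g∈x_b) g∈xᵢ with a Fin.≟ i
  ... | yes refl = g≢e (ics b (a≢b ∘ sym) _ g∈xᵢ g∈x_b)
  ... | no a≢i   = g≢e (ics a a≢i _ g∈xᵢ g∈xₐ)

module LowerBound (G : FinGroup) {m : ℕ} (xs : Fin m → El G)
                  (essential : IsEssentialCyclicSet G m xs) (3≤m : 3 ≤ m) where
  open FinGroup G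
  open CyclicSubgroups G
  open EnhancedPowerGraph G
  open EssentialCyclicSet G xs essential

  module _ {j : ℕ} (j<3 : j < 3) (ζ : EdgeColouring (EPAdj G) j)
           (rainbow : IsRainbowColouring (EPAdj G) ζ) where
    open EdgeColouring ζ
    open RainbowPaths ζ proj₁

    spokeColour : Fin m → Fin j
    spokeColour i = colour e (xs i) (spoke (generatorNonIdentity (ℕP.≤-trans (ℕP.n≤1+n 2) 3≤m) i))

    -- a rainbow path from xᵢ (i ∈ ics) to xₖ must be xᵢ – e – xₖ, with two colours
    spokesDiffer : ∀ {i k} → InIcs G m xs i → k ≢ i → spokeColour i ≢ spokeColour k
    spokesDiffer {i} {k} ics k≢i with rainbow (xs i) (xs k) (generator-injective (k≢i ∘ sym))
    ... | _ , walk , _ , rainbowColours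
      with twoColourRainbow j<3 walk rainbowColours (generator-injective (k≢i ∘ sym))
                            (generatorsNonAdjacent (k≢i ∘ sym))
    ... | y , a , b , a≢b
      with ics k k≢i y (neighbourIn a) (neighbourIn (adjacent-sym b))
    ... | refl = λ same → a≢b (begin
      colour (xs i) e a       ≡⟨ wellDef _ _ a _ ⟩
      spokeColour i           ≡⟨ same ⟩
      spokeColour k           ≡⟨ colour-irrelevant (adjacent-sym b) _ b ⟩
      colour e (xs k) b       ∎)
      where open ≡-Reasoning

  noSmallRainbow : ∀ {i₁ i₂} → i₁ ≢ i₂ → InIcs G m xs i₁ → InIcs G m xs i₂ →
                   ∀ j → j < 3 → ¬ HasRainbowColouring (EPAdj G) j
  noSmallRainbow {i₁} {i₂} i₁≢i₂ ics₁ ics₂ j j<3 (ζ , rainbow) with thirdIndex 3≤m i₁ i₂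
  ... | i₃ , i₃≢i₁ , i₃≢i₂ = noThreeDistinct j<3 (colourOf i₁) (colourOf i₂) (colourOf i₃)
        (spokesDiffer j<3 ζ rainbow ics₁ (i₁≢i₂ ∘ sym))
        (spokesDiffer j<3 ζ rainbow ics₁ i₃≢i₁)
        (spokesDiffer j<3 ζ rainbow ics₂ i₃≢i₂)
    where
    colourOf : Fin m → Fin j
    colourOf = spokeColour j<3 ζ rainbow

module UpperBound (G : FinGroup) {m : ℕ} (xs : Fin m → El G)
                  (essential : IsEssentialCyclicSet G m xs) (2≤m : 2 ≤ m)
                  (icn : IcnIs G m xs 2) where
  open FinGroup G
  open CyclicSubgroups G
  open EnhancedPowerGraph G
  open EssentialCyclicSet G xs essential

  private
    icsIndex : Fin 2 → Fin m
    icsIndex = proj₁ icn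
    icsIndex-ics : ∀ t → InIcs G m xs (icsIndex t)
    icsIndex-ics = proj₁ (proj₂ (proj₂ icn))
    icsIndex-onto : ∀ i → InIcs G m xs i → ∃ λ t → icsIndex t ≡ i
    icsIndex-onto = proj₂ (proj₂ (proj₂ icn))

  i₁ i₂ : Fin m
  i₁ = icsIndex Fin.zero
  i₂ = icsIndex (Fin.suc Fin.zero)

  x₁ x₂ : El G
  x₁ = xs i₁
  x₂ = xs i₂

  data Kind : Set where
    identity inX₁ inX₂ shared lone : Kind

  data Class (x : El G) : Kind → Set where
    isIdentity : x ≡ e → Class x identity
    isInX₁     : x ≢ e → x ∈⟨ x₁ ⟩ → Class x inX₁
    isInX₂     : x ≢ e → ¬ x ∈⟨ x₁ ⟩ → x ∈⟨ x₂ ⟩ → Class x inX₂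
    isShared   : x ≢ e → ¬ x ∈⟨ x₁ ⟩ → ¬ x ∈⟨ x₂ ⟩ → Shared x → Class x shared
    isLone     : x ≢ e → ¬ x ∈⟨ x₁ ⟩ → ¬ x ∈⟨ x₂ ⟩ → ¬ Shared x → Class x lone

  kind : El G → Kind
  kind x = if does (x Fin.≟ e) then identity
           else if does (x ∈?⟨ x₁ ⟩) then inX₁
           else if does (x ∈?⟨ x₂ ⟩) then inX₂
           else if does (shared? x) then shared
           else lone

  classify : ∀ x → ∃ (Class x)
  classify x with x Fin.≟ e | x ∈?⟨ x₁ ⟩ | x ∈?⟨ x₂ ⟩ | shared? x
  ... | yes x≡e | _        | _        | _     = _ , isIdentity x≡e
  ... | no x≢e  | yes x∈x₁ | _        | _     = _ , isInX₁ x≢e x∈x₁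
  ... | no x≢e  | no x∉x₁  | yes x∈x₂ | _     = _ , isInX₂ x≢e x∉x₁ x∈x₂
  ... | no x≢e  | no x∉x₁  | no x∉x₂  | yes s = _ , isShared x≢e x∉x₁ x∉x₂ s
  ... | no x≢e  | no x∉x₁  | no x∉x₂  | no ¬s = _ , isLone x≢e x∉x₁ x∉x₂ ¬s

  kind-of : ∀ {x k} → Class x k → kind x ≡ k
  kind-of {x} (isIdentity x≡e) rewrite dec-true (x Fin.≟ e) x≡e = refl
  kind-of {x} (isInX₁ x≢e x∈x₁)
    rewrite dec-false (x Fin.≟ e) x≢e | dec-true (x ∈?⟨ x₁ ⟩) x∈x₁ = refl
  kind-of {x} (isInX₂ x≢e x∉x₁ x∈x₂)
    rewrite dec-false (x Fin.≟ e) x≢e | dec-false (x ∈?⟨ x₁ ⟩) x∉x₁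
          | dec-true (x ∈?⟨ x₂ ⟩) x∈x₂ = refl
  kind-of {x} (isShared x≢e x∉x₁ x∉x₂ s)
    rewrite dec-false (x Fin.≟ e) x≢e | dec-false (x ∈?⟨ x₁ ⟩) x∉x₁
          | dec-false (x ∈?⟨ x₂ ⟩) x∉x₂ | dec-true (shared? x) s = refl
  kind-of {x} (isLone x≢e x∉x₁ x∉x₂ ¬s)
    rewrite dec-false (x Fin.≟ e) x≢e | dec-false (x ∈?⟨ x₁ ⟩) x∉x₁
          | dec-false (x ∈?⟨ x₂ ⟩) x∉x₂ | dec-false (shared? x) ¬s = refl

  identityClass : Class e identity
  identityClass = isIdentity refl

  classesDiffer : ∀ {x y k l} → Class x k → Class y l → k ≢ l → x ≢ y
  classesDiffer hx hy k≢l refl = k≢l (trans (sym (kind-of hx)) (kind-of hy))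

  -- Each kind gets a label; an edge is coloured by the sum of its end labels mod 3.
  -- Then the spokes e – v have colours 1, 2, 1, 0 for v of kind inX₁, inX₂, shared, lone,
  -- and edges between lone and shared vertices have colour 2.
  label : Kind → ℕ
  label identity = 1
  label inX₁     = 0
  label inX₂     = 1
  label shared   = 0
  label lone     = 2

  paint : Kind → Kind → Fin 3
  paint k l = (label k + label l) mod 3

  colouring : EdgeColouring (EPAdj G) 3
  colouring = record
    { colour  = λ x y _ → paint (kind x) (kind y)
    ; wellDef = λ x y _ _ → cong (_mod 3) (ℕP.+-comm (label (kind x)) (label (kind y)))
    }

  open RainbowPaths colouring proj₁

  Path : El G → El G → Set
  Path = RainbowPath (EPAdj G) colouring

  paintsDiffer : ∀ {x y z u kx ky kz ku} → Class x kx → Class y ky → Class z kz → Class u ku →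
                 paint kx ky ≢ paint kz ku → paint (kind x) (kind y) ≢ paint (kind z) (kind u)
  paintsDiffer {x} {y} {z} {u} {kx} {ky} {kz} {ku} hx hy hz hu differ same = differ (begin
    paint kx ky                ≡⟨ sym (cong₂ paint (kind-of hx) (kind-of hy)) ⟩
    paint (kind x) (kind y)    ≡⟨ same ⟩
    paint (kind z) (kind u)    ≡⟨ cong₂ paint (kind-of hz) (kind-of hu) ⟩
    paint kz ku                ∎)
    where open ≡-Reasoning

  twoStep : ∀ {x y z kx ky kz} → Class x kx → Class y ky → Class z kz →
            EPAdj G x y → EPAdj G y z → x ≢ z → paint kx ky ≢ paint ky kz → Path x z
  twoStep hx hy hz a b x≢z differ = twoEdgePath a b x≢z (paintsDiffer hx hy hy hz differ)

  threeStep : ∀ {x y z u kx ky kz ku} → Class x kx → Class y ky → Class z kz → Class u ku →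
              EPAdj G x y → EPAdj G y z → EPAdj G z u → x ≢ z → x ≢ u → y ≢ u →
              paint kx ky ≢ paint ky kz → paint kx ky ≢ paint kz ku → paint ky kz ≢ paint kz ku →
              Path x u
  threeStep hx hy hz hu a b c x≢z x≢u y≢u d₁ d₂ d₃ = threeEdgePath a b c x≢z x≢u y≢u
    (paintsDiffer hx hy hy hz d₁) (paintsDiffer hx hy hz hu d₂) (paintsDiffer hy hz hz hu d₃)

  nonIdentity : ∀ {x k} → Class x k → k ≢ identity → x ≢ e
  nonIdentity hx k≢identity = classesDiffer hx identityClass k≢identity

  viaIdentity : ∀ {x y k l} → Class x k → Class y l → k ≢ identity → l ≢ identity → x ≢ y →
                paint k identity ≢ paint identity l → Path x y
  viaIdentity hx hy k≢identity l≢identity =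
    twoStep hx identityClass hy (adjacent-sym (spoke (nonIdentity hx k≢identity)))
            (spoke (nonIdentity hy l≢identity))

  -- a shared vertex s ∈ ⟨xᵢ⟩ ∩ ⟨xₖ⟩ is adjacent to the lone vertex xᵢ
  loneNeighbour : ∀ {s} → Class s shared → ∃ λ g → Class g lone × EPAdj G g s
  loneNeighbour {s} hs@(isShared _ s∉x₁ s∉x₂ (i , _ , _ , s∈xᵢ , _)) =
    xs i , xᵢ-lone , classesDiffer xᵢ-lone hs (λ ()) , xs i , ∈-self (xs i) , s∈xᵢ
    where
    xᵢ-lone : Class (xs i) lone
    xᵢ-lone = isLone (generatorNonIdentity 2≤m i)
      (λ xᵢ∈x₁ → s∉x₁ (subst (λ t → s ∈⟨ xs t ⟩) (generatorIndex xᵢ∈x₁) s∈xᵢ))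
      (λ xᵢ∈x₂ → s∉x₂ (subst (λ t → s ∈⟨ xs t ⟩) (generatorIndex xᵢ∈x₂) s∈xᵢ))
      (λ (a , b , a≢b , xᵢ∈xₐ , xᵢ∈x_b) →
         a≢b (trans (sym (generatorIndex xᵢ∈xₐ)) (generatorIndex xᵢ∈x_b)))

  -- icn(G) = 2: the only members of ics(G) are x₁ and x₂
  outsideIcs : ∀ {y i} → ¬ y ∈⟨ x₁ ⟩ → ¬ y ∈⟨ x₂ ⟩ → y ∈⟨ xs i ⟩ → ¬ InIcs G m xs i
  outsideIcs {i = i} y∉x₁ y∉x₂ y∈xᵢ icsᵢ with icsIndex-onto i icsᵢ
  ... | Fin.zero , refl           = y∉x₁ y∈xᵢ
  ... | Fin.suc Fin.zero , refl   = y∉x₂ y∈xᵢ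

  -- a lone vertex y ∈ ⟨xᵢ⟩ is adjacent to a shared element of ⟨xᵢ⟩, as xᵢ ∉ ics(G)
  sharedNeighbour : ∀ {y} → Class y lone → ∃ λ s → Class s shared × EPAdj G y s
  sharedNeighbour {y} hy@(isLone _ y∉x₁ y∉x₂ _) with covered y
  ... | i , y∈xᵢ with sharedWitness i (outsideIcs y∉x₁ y∉x₂ y∈xᵢ)
  ...   | g , g≢e , g∈xᵢ , k , k≢i , g∈xₖ =
    g , g-shared , classesDiffer hy g-shared (λ ()) , xs i , y∈xᵢ , g∈xᵢ
    where
    g-is-shared : Shared g
    g-is-shared = i , k , k≢i ∘ sym , g∈xᵢ , g∈xₖ
    g-shared : Class g shared
    g-shared = isShared g≢e (icsAvoidsShared (icsIndex-ics Fin.zero) g≢e g-is-shared)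
                            (icsAvoidsShared (icsIndex-ics (Fin.suc Fin.zero)) g≢e g-is-shared)
                            g-is-shared

  -- a rainbow path between any two distinct vertices, by the kinds of its ends: an edge,
  -- a path through e, or a three-edge path through e and a lone/shared neighbour
  connect : ∀ {x y k l} → Class x k → Class y l → x ≢ y → Path x y
  connect (isIdentity refl) _ x≢y = edgePath (spoke (x≢y ∘ sym))
  connect _ (isIdentity refl) x≢y = edgePath (adjacent-sym (spoke x≢y))
  connect (isInX₁ _ x∈x₁) (isInX₁ _ y∈x₁) x≢y = edgePath (x≢y , x₁ , x∈x₁ , y∈x₁)
  connect (isInX₂ _ _ x∈x₂) (isInX₂ _ _ y∈x₂) x≢y = edgePath (x≢y , x₂ , x∈x₂ , y∈x₂)
  connect hx@(isInX₁ _ _) hy@(isInX₂ _ _ _) x≢y = viaIdentity hx hy (λ ()) (λ ()) x≢y (λ ())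
  connect hx@(isInX₂ _ _ _) hy@(isInX₁ _ _) x≢y = viaIdentity hx hy (λ ()) (λ ()) x≢y (λ ())
  connect hx@(isInX₁ _ _) hy@(isLone _ _ _ _) x≢y = viaIdentity hx hy (λ ()) (λ ()) x≢y (λ ())
  connect hx@(isLone _ _ _ _) hy@(isInX₁ _ _) x≢y = viaIdentity hx hy (λ ()) (λ ()) x≢y (λ ())
  connect hx@(isInX₂ _ _ _) hy@(isLone _ _ _ _) x≢y = viaIdentity hx hy (λ ()) (λ ()) x≢y (λ ())
  connect hx@(isLone _ _ _ _) hy@(isInX₂ _ _ _) x≢y = viaIdentity hx hy (λ ()) (λ ()) x≢y (λ ())
  connect hx@(isInX₂ _ _ _) hy@(isShared _ _ _ _) x≢y = viaIdentity hx hy (λ ()) (λ ()) x≢y (λ ())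
  connect hx@(isShared _ _ _ _) hy@(isInX₂ _ _ _) x≢y = viaIdentity hx hy (λ ()) (λ ()) x≢y (λ ())
  connect hx@(isLone _ _ _ _) hy@(isShared _ _ _ _) x≢y = viaIdentity hx hy (λ ()) (λ ()) x≢y (λ ())
  connect hx@(isShared _ _ _ _) hy@(isLone _ _ _ _) x≢y = viaIdentity hx hy (λ ()) (λ ()) x≢y (λ ())
  connect hx@(isInX₁ _ _) hs@(isShared _ _ _ _) x≢s with loneNeighbour hs
  ... | g , hg , g~s = threeStep hx identityClass hg hs
          (adjacent-sym (spoke (nonIdentity hx (λ ())))) (spoke (nonIdentity hg (λ ()))) g~s
          (classesDiffer hx hg (λ ())) x≢s (classesDiffer identityClass hs (λ ()))
          (λ ()) (λ ()) (λ ())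
  connect hs@(isShared _ _ _ _) hx@(isInX₁ _ _) s≢x with loneNeighbour hs
  ... | g , hg , g~s = threeStep hs hg identityClass hx
          (adjacent-sym g~s) (adjacent-sym (spoke (nonIdentity hg (λ ())))) (spoke (nonIdentity hx (λ ())))
          (nonIdentity hs (λ ())) s≢x (classesDiffer hg hx (λ ()))
          (λ ()) (λ ()) (λ ())
  connect hy@(isLone _ _ _ _) hy′@(isLone _ _ _ _) y≢y′ with sharedNeighbour hy
  ... | s , hs , y~s = threeStep hy hs identityClass hy′
          y~s (adjacent-sym (spoke (nonIdentity hs (λ ())))) (spoke (nonIdentity hy′ (λ ())))
          (nonIdentity hy (λ ())) y≢y′ (classesDiffer hs hy′ (λ ()))
          (λ ()) (λ ()) (λ ())
  connect hs@(isShared _ _ _ _) hs′@(isShared _ _ _ _) s≢s′ with loneNeighbour hs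
  ... | g , hg , g~s = threeStep hs hg identityClass hs′
          (adjacent-sym g~s) (adjacent-sym (spoke (nonIdentity hg (λ ())))) (spoke (nonIdentity hs′ (λ ())))
          (nonIdentity hs (λ ())) s≢s′ (classesDiffer hg hs′ (λ ()))
          (λ ()) (λ ()) (λ ())

  rainbowColouring : HasRainbowColouring (EPAdj G) 3
  rainbowColouring = colouring , λ x y x≢y → connect (proj₂ (classify x)) (proj₂ (classify y)) x≢y

twoIcsMembers : ∀ (G : FinGroup) {m c} (xs : Fin m → El G) → 2 ≤ c → IcnIs G m xs c →
                ∃ λ i₁ → ∃ λ i₂ → i₁ ≢ i₂ × InIcs G m xs i₁ × InIcs G m xs i₂
twoIcsMembers G xs (s≤s (s≤s _)) (icsIndex , injective , ics , _) =
  icsIndex Fin.zero , icsIndex (Fin.suc Fin.zero) ,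
  (λ same → case injective same of λ ()) , ics Fin.zero , ics (Fin.suc Fin.zero)

theorem3p4 : (G : FinGroup) (m : ℕ) (xs : Fin m → El G) →
    IsEssentialCyclicSet G m xs → 4 ≤ m → IcnIs G m xs 2 →
    RcIs (EPAdj G) 3
theorem3p4 G m xs essential 4≤m icn with twoIcsMembers G xs ℕP.≤-refl icn
... | i₁ , i₂ , i₁≢i₂ , ics₁ , ics₂ =
    UpperBound.rainbowColouring G xs essential 2≤m icn
  , LowerBound.noSmallRainbow G xs essential 3≤m i₁≢i₂ ics₁ ics₂
  where
  3≤m : 3 ≤ m
  3≤m = ℕP.≤-trans (ℕP.n≤1+n 3) 4≤m
  2≤m : 2 ≤ m
  2≤m = ℕP.≤-trans (ℕP.n≤1+n 2) 3≤m
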